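{- Let $N = q^k n^2$ be an odd perfect number, where $q$ is a prime with $q \equiv k \equiv 1 \pmod 4$ and $\gcd(q,n)=1$. Then $k=1$ if and only if $D(n^2) \mid n^2$.
   Context: For a positive integer $N$, $\sigma(N)$ denotes the sum of the positive divisors of $N$; $N$ is perfect if $\sigma(N)=2N$. The deficiency of a positive integer $x$ is $D(x) = 2x - \sigma(x)$. -}

module Defs where

open import Data.Nat using (ℕ; suc; _*_; _+_)
open import Data.Nat.Divisibility using (_∣?_)
open import Data.List using (filter; upTo; map)
open import Data.Nat.ListAction using (sum)
open import Relation.Binary.PropositionalEquality using (_≡_)
open import Data.Integer as ℤ using (ℤ; +_)

σ : ℕ → ℕ
σ N = sum (filter (_∣? N) (map suc (upTo N)))

Perfect : ℕ → Set
Perfect N = σ N ≡ 2 * N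

D : ℕ → ℤ
D x = (+ (2 * x)) ℤ.- (+ σ x)

module Submission where

-- Let N = q^k·m be perfect with q prime, q ∤ m (here m = n²) and k = k' + 1.
-- Everything rests on the recursion, for p prime and p ∤ m,
--     σ(p·p^j·m) = p·σ(p^j·m) + σ(m),
-- obtained by splitting the divisors of p^(j+1)·m into the multiples of p (which are p times the
-- divisors of p^j·m) and the others (which are exactly the divisors of m).  It yields
-- σ(p^j·m) = σ(p^j)·σ(m), σ(p^(j+1)) = p·σ(p^j) + 1 = p^(j+1) + σ(p^j), and gcd(p^j, σ(p^j)) = 1.
-- For the perfect number this gives σ(q^k)·σ(m) = 2·q^k·m, hence q^k ∣ σ(m); writing
-- σ(m) = t·q^k we get σ(q^k)·t = 2m and D(m) = 2m − σ(m) = σ(q^k')·t.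
--   * If k = 1 then D(m) = t and (q + 1)·t = 2m with q odd, so t ∣ m.
--   * If σ(q^k')·t ∣ m, say m = c·σ(q^k')·t, then (q·σ(q^k') + 1)·t = 2c·σ(q^k')·t forces
--     σ(q^k') ∣ 1, and σ(q^k') = 1 only for k' = 0.
-- The module below develops finite sums Σ_{i<M} f(i), σ as such a sum, the recursion and its
-- consequences, and the Euler-form argument; lemma3 is assembled from it at the end.

open import Defs

module DivisorSums where

  open import Data.Nat
  open import Data.Nat.Properties
  open import Data.Nat.Divisibility
  open import Data.Nat.DivMod using (_/_; m≡m%n+[m/n]*n; m∣n⇒o%n%m≡o%m)
  open import Data.Nat.Primality using (Prime; prime⇒irreducible; prime⇒nonZero)
  open import Data.Nat.Coprimality using (Coprime; coprime-divisor)
  open import Data.Nat.Tactic.RingSolver using (solve-∀)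
  open import Data.Nat.ListAction using (sum)
  open import Data.List using (List; []; _∷_; filter; upTo; map; applyUpTo)
  open import Data.List.Properties using (map-∘)
  import Data.Integer as ℤ
  import Data.Integer.Properties as ℤP
  import Data.Integer.Divisibility as ℤD
  open import Data.Sum using (inj₁; inj₂)
  open import Data.Product using (_,_)
  open import Relation.Nullary using (Dec; yes; no; ¬_; contradiction)
  open import Relation.Binary.PropositionalEquality
  open import Function using (_∘_)
  open import Function.Bundles using (_⇔_; mk⇔)

  sumBelow : (ℕ → ℕ) → ℕ → ℕ
  sumBelow f zero    = 0
  sumBelow f (suc M) = sumBelow f M + f M

  -- Peeling off the first term; this links sumBelow to the cons-lists of σ's definition.
  sumBelow-suc : ∀ f M → sumBelow f (suc M) ≡ f 0 + sumBelow (f ∘ suc) M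
  sumBelow-suc f zero    = sym (+-identityʳ (f 0))
  sumBelow-suc f (suc M) rewrite sumBelow-suc f M = +-assoc (f 0) (sumBelow (f ∘ suc) M) (f (suc M))

  sum-applyUpTo : ∀ (f g : ℕ → ℕ) M → sum (map f (applyUpTo g M)) ≡ sumBelow (f ∘ g) M
  sum-applyUpTo f g zero    = refl
  sum-applyUpTo f g (suc M) rewrite sum-applyUpTo f (g ∘ suc) M = sym (sumBelow-suc (f ∘ g) M)

  sumBelow-cong : ∀ {f g} M → (∀ i → f i ≡ g i) → sumBelow f M ≡ sumBelow g M
  sumBelow-cong zero    f≗g = refl
  sumBelow-cong (suc M) f≗g = cong₂ _+_ (sumBelow-cong M f≗g) (f≗g M)

  sumBelow-+ : ∀ f g M → sumBelow (λ i → f i + g i) M ≡ sumBelow f M + sumBelow g M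
  sumBelow-+ f g zero    = refl
  sumBelow-+ f g (suc M) rewrite sumBelow-+ f g M = interchange (sumBelow f M) (sumBelow g M) (f M) (g M)
    where
    interchange : ∀ a b c d → a + b + (c + d) ≡ a + c + (b + d)
    interchange = solve-∀

  sumBelow-*ˡ : ∀ c f M → sumBelow (λ i → c * f i) M ≡ c * sumBelow f M
  sumBelow-*ˡ c f zero    = sym (*-zeroʳ c)
  sumBelow-*ˡ c f (suc M) rewrite sumBelow-*ˡ c f M = sym (*-distribˡ-+ c (sumBelow f M) (f M))

  sumBelow-split : ∀ f a b → sumBelow f (a + b) ≡ sumBelow f a + sumBelow (λ i → f (a + i)) b
  sumBelow-split f a zero    rewrite +-identityʳ a = sym (+-identityʳ (sumBelow f a))
  sumBelow-split f a (suc b) rewrite +-suc a b | sumBelow-split f a b = +-assoc (sumBelow f a) _ _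

  sumBelow-vanish : ∀ f M → (∀ i → i < M → f i ≡ 0) → sumBelow f M ≡ 0
  sumBelow-vanish f zero    f≡0 = refl
  sumBelow-vanish f (suc M) f≡0
    rewrite sumBelow-vanish f M (λ i i<M → f≡0 i (m<n⇒m<1+n i<M)) | f≡0 M ≤-refl = refl

  keepIf : ∀ {P : Set} → Dec P → ℕ → ℕ
  keepIf (yes _) x = x
  keepIf (no _)  _ = 0

  dropIf : ∀ {P : Set} → Dec P → ℕ → ℕ
  dropIf (yes _) _ = 0
  dropIf (no _)  x = x

  keepIf+dropIf : ∀ {P : Set} (P? : Dec P) x → keepIf P? x + dropIf P? x ≡ x
  keepIf+dropIf (yes _) x = +-identityʳ x
  keepIf+dropIf (no _)  x = refl

  keepIf-yes : ∀ {P : Set} (P? : Dec P) {x} → P → keepIf P? x ≡ x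
  keepIf-yes (yes _) _ = refl
  keepIf-yes (no ¬p) p = contradiction p ¬p

  keepIf-no : ∀ {P : Set} (P? : Dec P) {x} → ¬ P → keepIf P? x ≡ 0
  keepIf-no (yes p) ¬p = contradiction p ¬p
  keepIf-no (no _)  _  = refl

  divTerm : ℕ → ℕ → ℕ
  divTerm N d = keepIf (d ∣? N) d

  sum-filter-divisors : ∀ N (ds : List ℕ) → sum (filter (_∣? N) ds) ≡ sum (map (divTerm N) ds)
  sum-filter-divisors N []       = refl
  sum-filter-divisors N (d ∷ ds) with d ∣? N
  ... | yes _ = cong (d +_) (sum-filter-divisors N ds)
  ... | no _  = sum-filter-divisors N ds

  σ-as-sum : ∀ N → σ N ≡ sumBelow (divTerm N ∘ suc) N
  σ-as-sum N = begin
    sum (filter (_∣? N) (map suc (upTo N)))  ≡⟨ sum-filter-divisors N (map suc (upTo N)) ⟩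
    sum (map (divTerm N) (map suc (upTo N))) ≡⟨ cong sum (sym (map-∘ (upTo N))) ⟩
    sum (map (divTerm N ∘ suc) (upTo N))     ≡⟨ sum-applyUpTo (divTerm N ∘ suc) (λ i → i) N ⟩
    sumBelow (divTerm N ∘ suc) N             ∎
    where open ≡-Reasoning

  -- Candidates beyond m contribute nothing, so the divisor sum may run over any range [1, M] ⊇ [1, m].
  σ-over-longer-range : ∀ m M → m ≢ 0 → m ≤ M → sumBelow (divTerm m ∘ suc) M ≡ σ m
  σ-over-longer-range m M m≢0 m≤M = begin
    sumBelow (divTerm m ∘ suc) M
      ≡⟨ cong (sumBelow (divTerm m ∘ suc)) (sym (m+[n∸m]≡n m≤M)) ⟩
    sumBelow (divTerm m ∘ suc) (m + (M ∸ m))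
      ≡⟨ sumBelow-split (divTerm m ∘ suc) m (M ∸ m) ⟩
    sumBelow (divTerm m ∘ suc) m + sumBelow (λ i → divTerm m (suc (m + i))) (M ∸ m)
      ≡⟨ cong (sumBelow (divTerm m ∘ suc) m +_) (sumBelow-vanish _ (M ∸ m) beyond-m) ⟩
    sumBelow (divTerm m ∘ suc) m + 0
      ≡⟨ +-identityʳ _ ⟩
    sumBelow (divTerm m ∘ suc) m
      ≡⟨ sym (σ-as-sum m) ⟩
    σ m ∎
    where
    open ≡-Reasoning
    beyond-m : ∀ i → i < M ∸ m → divTerm m (suc (m + i)) ≡ 0
    beyond-m i _ = keepIf-no (suc (m + i) ∣? m)
      (λ d∣m → <⇒≱ (s≤s (m≤m+n m i)) (∣⇒≤ {{≢-nonZero m≢0}} d∣m))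

  sumBelow-multiples : ∀ p .{{_ : NonZero p}} (h : ℕ → ℕ) X →
    sumBelow (λ i → keepIf (p ∣? suc i) (h (suc i))) (p * X) ≡ sumBelow (λ j → h (p * suc j)) X
  sumBelow-multiples p@(suc p′) h = go
    where
    F : ℕ → ℕ
    F i = keepIf (p ∣? suc i) (h (suc i))

    -- In the block p·X + [0, p) only the last index carries a multiple of p.
    inside-block : ∀ X i → i < p′ → F (p * X + i) ≡ 0
    inside-block X i i<p′ = keepIf-no (p ∣? suc (p * X + i)) λ p∣ →
      <⇒≱ i<p′ (≤-pred (∣⇒≤ (∣m+n∣m⇒∣n (subst (p ∣_) (sym (+-suc (p * X) i)) p∣) (m∣m*n X))))

    end-of-block : ∀ X → suc (p * X + p′) ≡ p * suc X
    end-of-block X = trans (cong suc (+-comm (p * X) p′)) (sym (*-suc p X))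

    block : ∀ X → sumBelow (λ i → F (p * X + i)) p ≡ h (p * suc X)
    block X = cong₂ _+_ (sumBelow-vanish (λ i → F (p * X + i)) p′ (inside-block X))
      (trans (keepIf-yes (p ∣? _) (subst (p ∣_) (sym (end-of-block X)) (m∣m*n (suc X))))
             (cong h (end-of-block X)))

    go : ∀ X → sumBelow F (p * X) ≡ sumBelow (λ j → h (p * suc j)) X
    go zero    = cong (sumBelow F) (*-zeroʳ p)
    go (suc X) = begin
      sumBelow F (p * suc X)                                ≡⟨ cong (sumBelow F) (trans (*-suc p X) (+-comm p (p * X))) ⟩
      sumBelow F (p * X + p)                                ≡⟨ sumBelow-split F (p * X) p ⟩
      sumBelow F (p * X) + sumBelow (λ i → F (p * X + i)) p ≡⟨ cong₂ _+_ (go X) (block X) ⟩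
      sumBelow (λ j → h (p * suc j)) X + h (p * suc X)      ∎
      where open ≡-Reasoning

  coprime-divisor-pow : ∀ {d p} j m → Coprime d p → d ∣ p ^ j * m → d ∣ m
  coprime-divisor-pow {d} zero    m _   d∣ = subst (d ∣_) (*-identityˡ m) d∣
  coprime-divisor-pow {d} {p} (suc j) m d⊥p d∣ =
    coprime-divisor-pow j m d⊥p (coprime-divisor d⊥p (subst (d ∣_) (*-assoc p (p ^ j) m) d∣))

  -- For odd q, (q + 1)·t = 2m forces t ∣ m, the quotient being (q + 1)/2.
  odd-succ-cancel : ∀ q t m → q % 2 ≡ 1 → (q + 1) * t ≡ 2 * m → t ∣ m
  odd-succ-cancel q t m q-odd eq = divides (1 + q / 2) (sym (*-cancelˡ-≡ _ _ 2 (begin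
      2 * ((1 + q / 2) * t)        ≡⟨ halve (q / 2) t ⟩
      (1 + q / 2 * 2 + 1) * t      ≡⟨ cong (λ r → (r + q / 2 * 2 + 1) * t) (sym q-odd) ⟩
      (q % 2 + q / 2 * 2 + 1) * t  ≡⟨ cong (λ x → (x + 1) * t) (sym (m≡m%n+[m/n]*n q 2)) ⟩
      (q + 1) * t                  ≡⟨ eq ⟩
      2 * m                        ∎)))
    where
    open ≡-Reasoning
    halve : ∀ a t → 2 * ((1 + a) * t) ≡ (1 + a * 2 + 1) * t
    halve = solve-∀

  deficiency-≡ : ∀ x a b → σ x ≡ a → 2 * x ≡ a + b → D x ≡ ℤ.+ b
  deficiency-≡ x a b σx≡a 2x≡a+b = begin
    ℤ.+ (2 * x) ℤ.- ℤ.+ σ x  ≡⟨ cong₂ (λ u v → ℤ.+ u ℤ.- ℤ.+ v) 2x≡a+b σx≡a ⟩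
    ℤ.+ (a + b) ℤ.- ℤ.+ a    ≡⟨ ℤP.[+m]-[+n]≡m⊖n (a + b) a ⟩
    (a + b) ℤ.⊖ a            ≡⟨ ℤP.⊖-≥ (m≤m+n a b) ⟩
    ℤ.+ (a + b ∸ a)          ≡⟨ cong ℤ.+_ (m+n∸m≡n a b) ⟩
    ℤ.+ b                    ∎
    where open ≡-Reasoning

  module PrimeSigma (p : ℕ) (p-prime : Prime p) where

    instance
      p≢0 : NonZero p
      p≢0 = prime⇒nonZero p-prime

    p∤1 : ¬ p ∣ 1
    p∤1 p∣1 = <⇒≢ (nonTrivial⇒n>1 p) (sym (∣1⇒≡1 p∣1))
      where open Prime p-prime

    ¬∣⇒coprime : ∀ {d} → ¬ p ∣ d → Coprime d p
    ¬∣⇒coprime p∤d {i} (i∣d , i∣p) with prime⇒irreducible p-prime i∣p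
    ... | inj₁ i≡1 = i≡1
    ... | inj₂ refl = contradiction i∣d p∤d

    -- The multiples of p among the divisors of p·X are p times the divisors of X.
    σ-multiples-part : ∀ X → sumBelow (λ i → keepIf (p ∣? suc i) (divTerm (p * X) (suc i))) (p * X) ≡ p * σ X
    σ-multiples-part X = begin
      sumBelow (λ i → keepIf (p ∣? suc i) (divTerm (p * X) (suc i))) (p * X)
        ≡⟨ sumBelow-multiples p (divTerm (p * X)) X ⟩
      sumBelow (λ j → divTerm (p * X) (p * suc j)) X
        ≡⟨ sumBelow-cong X (λ j → divTerm-scale (suc j)) ⟩
      sumBelow (λ j → p * divTerm X (suc j)) X
        ≡⟨ sumBelow-*ˡ p (divTerm X ∘ suc) X ⟩
      p * sumBelow (divTerm X ∘ suc) X
        ≡⟨ cong (p *_) (sym (σ-as-sum X)) ⟩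
      p * σ X ∎
      where
      open ≡-Reasoning
      divTerm-scale : ∀ d → divTerm (p * X) (p * d) ≡ p * divTerm X d
      divTerm-scale d with d ∣? X
      ... | yes d∣X = keepIf-yes (p * d ∣? p * X) (*-monoʳ-∣ p d∣X)
      ... | no d∤X  = trans (keepIf-no (p * d ∣? p * X) (d∤X ∘ *-cancelˡ-∣ p)) (sym (*-zeroʳ p))

    σ-coprime-part : ∀ j m → ¬ p ∣ m →
      sumBelow (λ i → dropIf (p ∣? suc i) (divTerm (p * (p ^ j * m)) (suc i))) (p * (p ^ j * m)) ≡ σ m
    σ-coprime-part j m p∤m = trans (sumBelow-cong N same-term)
                                   (σ-over-longer-range m N m≢0 m≤N)
      where
      N : ℕ
      N = p * (p ^ j * m)

      m≢0 : m ≢ 0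
      m≢0 refl = p∤m (p ∣0)

      m≤N : m ≤ N
      m≤N = ≤-trans (m≤n*m m (p ^ j) {{m^n≢0 p j}}) (m≤n*m (p ^ j * m) p)

      same-term : ∀ i → dropIf (p ∣? suc i) (divTerm N (suc i)) ≡ divTerm m (suc i)
      same-term i with p ∣? suc i
      ... | yes p∣d = sym (keepIf-no (suc i ∣? m) (p∤m ∘ ∣-trans p∣d))
      ... | no p∤d  with suc i ∣? m
      ...   | yes d∣m = keepIf-yes (suc i ∣? N) (∣-trans d∣m (∣-trans (n∣m*n (p ^ j)) (n∣m*n p)))
      ...   | no d∤m  = keepIf-no (suc i ∣? N) λ d∣N → d∤m
                (coprime-divisor-pow j m (¬∣⇒coprime p∤d) (coprime-divisor (¬∣⇒coprime p∤d) d∣N))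

    σ-recursion : ∀ j m → ¬ p ∣ m → σ (p * (p ^ j * m)) ≡ p * σ (p ^ j * m) + σ m
    σ-recursion j m p∤m = begin
      σ N                                       ≡⟨ σ-as-sum N ⟩
      sumBelow (divTerm N ∘ suc) N              ≡⟨ sumBelow-cong N (λ i → sym (keepIf+dropIf (p ∣? suc i) _)) ⟩
      sumBelow (λ i → keep i + drop i) N        ≡⟨ sumBelow-+ keep drop N ⟩
      sumBelow keep N + sumBelow drop N         ≡⟨ cong₂ _+_ (σ-multiples-part (p ^ j * m)) (σ-coprime-part j m p∤m) ⟩
      p * σ (p ^ j * m) + σ m                   ∎
      where
      open ≡-Reasoning
      N : ℕ
      N = p * (p ^ j * m)
      keep drop : ℕ → ℕ
      keep i = keepIf (p ∣? suc i) (divTerm N (suc i))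
      drop i = dropIf (p ∣? suc i) (divTerm N (suc i))

    σ-pow-suc : ∀ j → σ (p ^ suc j) ≡ p * σ (p ^ j) + 1
    σ-pow-suc j = begin
      σ (p * p ^ j)                 ≡⟨ cong (λ x → σ (p * x)) (sym (*-identityʳ (p ^ j))) ⟩
      σ (p * (p ^ j * 1))           ≡⟨ σ-recursion j 1 p∤1 ⟩
      p * σ (p ^ j * 1) + 1         ≡⟨ cong (λ x → p * σ x + 1) (*-identityʳ (p ^ j)) ⟩
      p * σ (p ^ j) + 1             ∎
      where open ≡-Reasoning

    σ-multiplicative : ∀ j m → ¬ p ∣ m → σ (p ^ j * m) ≡ σ (p ^ j) * σ m
    σ-multiplicative zero    m _   = trans (cong σ (+-identityʳ m)) (sym (+-identityʳ (σ m)))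
    σ-multiplicative (suc j) m p∤m = begin
      σ (p * p ^ j * m)             ≡⟨ cong σ (*-assoc p (p ^ j) m) ⟩
      σ (p * (p ^ j * m))           ≡⟨ σ-recursion j m p∤m ⟩
      p * σ (p ^ j * m) + σ m       ≡⟨ cong (λ x → p * x + σ m) (σ-multiplicative j m p∤m) ⟩
      p * (σ (p ^ j) * σ m) + σ m   ≡⟨ factor p (σ (p ^ j)) (σ m) ⟩
      (p * σ (p ^ j) + 1) * σ m     ≡⟨ cong (_* σ m) (sym (σ-pow-suc j)) ⟩
      σ (p ^ suc j) * σ m           ∎
      where
      open ≡-Reasoning
      factor : ∀ p a b → p * (a * b) + b ≡ (p * a + 1) * b
      factor = solve-∀

    -- σ(p^(j+1)) = p^(j+1) + σ(p^j): the top divisor plus all the others.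
    σ-pow-top : ∀ j → σ (p ^ suc j) ≡ p ^ suc j + σ (p ^ j)
    σ-pow-top zero    = σ-pow-suc 0
    σ-pow-top (suc j) = begin
      σ (p ^ suc (suc j))                 ≡⟨ σ-pow-suc (suc j) ⟩
      p * σ (p ^ suc j) + 1               ≡⟨ cong (λ x → p * x + 1) (σ-pow-top j) ⟩
      p * (p ^ suc j + σ (p ^ j)) + 1     ≡⟨ regroup p (p ^ suc j) (σ (p ^ j)) ⟩
      p * p ^ suc j + (p * σ (p ^ j) + 1) ≡⟨ cong (p * p ^ suc j +_) (sym (σ-pow-suc j)) ⟩
      p ^ suc (suc j) + σ (p ^ suc j)     ∎
      where
      open ≡-Reasoning
      regroup : ∀ p x s → p * (x + s) + 1 ≡ p * x + (p * s + 1)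
      regroup = solve-∀

    -- Since σ(p^j) ≡ 1 (mod p), it shares no factor with p^j.
    σ-pow-coprime : ∀ j → Coprime (p ^ j) (σ (p ^ j))
    σ-pow-coprime zero    {i} (i∣1 , _)    = ∣1⇒≡1 i∣1
    σ-pow-coprime (suc j) {i} (i∣pʲ⁺¹ , i∣σ) =
      ∣1⇒≡1 (coprime-divisor-pow (suc j) 1 i⊥p (subst (i ∣_) (sym (*-identityʳ (p ^ suc j))) i∣pʲ⁺¹))
      where
      i⊥p : Coprime i p
      i⊥p {d} (d∣i , d∣p) = ∣1⇒≡1 (∣m+n∣m⇒∣n (subst (d ∣_) (σ-pow-suc j) (∣-trans d∣i i∣σ))
                                             (∣-trans d∣p (m∣m*n (σ (p ^ j)))))

    -- σ(p^j) = 1 only for j = 0, since σ(p^(j+1)) ≥ p^(j+1) ≥ p > 1.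
    σ-pow≡1 : ∀ j → σ (p ^ j) ≡ 1 → j ≡ 0
    σ-pow≡1 zero    _   = refl
    σ-pow≡1 (suc j) σ≡1 = contradiction (begin-strict
        1                       <⟨ nonTrivial⇒n>1 p ⟩
        p                       ≤⟨ m≤m*n p (p ^ j) {{m^n≢0 p j}} ⟩
        p ^ suc j               ≤⟨ m≤m+n _ _ ⟩
        p ^ suc j + σ (p ^ j)   ≡⟨ sym (σ-pow-top j) ⟩
        σ (p ^ suc j)           ≡⟨ σ≡1 ⟩
        1                       ∎) (<-irrefl refl)
      where
      open ≤-Reasoning
      open Prime p-prime

  module EulerForm (p k m : ℕ) (p-prime : Prime p) (p∤m : ¬ p ∣ m)
                   (perfect : σ (p ^ suc k * m) ≡ 2 * (p ^ suc k * m)) where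

    open PrimeSigma p p-prime

    Q s : ℕ
    Q = p ^ suc k
    s = σ (p ^ k)

    instance
      Q≢0 : NonZero Q
      Q≢0 = m^n≢0 p (suc k)

    σQσm≡2Qm : σ Q * σ m ≡ Q * (2 * m)
    σQσm≡2Qm = begin
      σ Q * σ m        ≡⟨ sym (σ-multiplicative (suc k) m p∤m) ⟩
      σ (Q * m)        ≡⟨ perfect ⟩
      2 * (Q * m)      ≡⟨ swap 2 Q m ⟩
      Q * (2 * m)      ∎
      where
      open ≡-Reasoning
      swap : ∀ a b c → a * (b * c) ≡ b * (a * c)
      swap = solve-∀

    -- Q is coprime to σ(Q) and divides σ(Q)·σ(m), so Q ∣ σ(m).
    Q∣σm : Q ∣ σ m
    Q∣σm = coprime-divisor (σ-pow-coprime (suc k)) (subst (Q ∣_) (sym σQσm≡2Qm) (m∣m*n (2 * m)))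

    t : ℕ
    t = _∣_.quotient Q∣σm

    σm≡tQ : σ m ≡ t * Q
    σm≡tQ = _∣_.equality Q∣σm

    σQt≡2m : σ Q * t ≡ 2 * m
    σQt≡2m = *-cancelʳ-≡ _ _ Q (begin
      σ Q * t * Q      ≡⟨ *-assoc (σ Q) t Q ⟩
      σ Q * (t * Q)    ≡⟨ cong (σ Q *_) (sym σm≡tQ) ⟩
      σ Q * σ m        ≡⟨ σQσm≡2Qm ⟩
      Q * (2 * m)      ≡⟨ *-comm Q (2 * m) ⟩
      2 * m * Q        ∎)
      where open ≡-Reasoning

    -- D(m) = 2m − σ(m) = (Q + s)·t − t·Q = s·t.
    deficiency : D m ≡ ℤ.+ (s * t)
    deficiency = deficiency-≡ m (t * Q) (s * t) σm≡tQ (begin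
      2 * m            ≡⟨ sym σQt≡2m ⟩
      σ Q * t          ≡⟨ cong (_* t) (σ-pow-top k) ⟩
      (Q + s) * t      ≡⟨ expand Q s t ⟩
      t * Q + s * t    ∎)
      where
      open ≡-Reasoning
      expand : ∀ Q s t → (Q + s) * t ≡ t * Q + s * t
      expand = solve-∀

    -- For k = 0 the deficiency is t, and (p + 1)·t = 2m with p odd.
    k≡0⇒D∣m : p % 2 ≡ 1 → k ≡ 0 → D m ℤD.∣ ℤ.+ m
    k≡0⇒D∣m p-odd refl = subst (ℤD._∣ ℤ.+ m) (sym deficiency)
      (subst (_∣ m) (sym (*-identityˡ t)) (odd-succ-cancel p t m p-odd (begin
        (p + 1) * t      ≡⟨ cong (λ x → (x + 1) * t) (sym (*-identityʳ p)) ⟩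
        (p ^ 1 + 1) * t  ≡⟨ cong (_* t) (sym (σ-pow-top 0)) ⟩
        σ Q * t          ≡⟨ σQt≡2m ⟩
        2 * m            ∎)))
      where open ≡-Reasoning

    -- If s·t ∣ m, say m = c·s·t, then (p·s + 1)·t = 2c·s·t; cancelling t gives s ∣ 1.
    D∣m⇒k≡0 : D m ℤD.∣ ℤ.+ m → k ≡ 0
    D∣m⇒k≡0 D∣m = σ-pow≡1 k (∣1⇒≡1 (∣m+n∣m⇒∣n (subst (s ∣_) (sym ps+1≡2cs) (n∣m*n (2 * c))) (n∣m*n p)))
      where
      st∣m : s * t ∣ m
      st∣m = subst (ℤD._∣ ℤ.+ m) deficiency D∣m
      c : ℕ
      c = _∣_.quotient st∣m

      t≢0 : t ≢ 0
      t≢0 t≡0 = p∤m (subst (p ∣_) (sym m≡0) (p ∣0))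
        where
        m≡0 : m ≡ 0
        m≡0 = *-cancelˡ-≡ m 0 2 (trans (sym σQt≡2m) (trans (cong (σ Q *_) t≡0) (*-zeroʳ (σ Q))))

      ps+1≡2cs : p * s + 1 ≡ 2 * c * s
      ps+1≡2cs = *-cancelʳ-≡ _ _ t {{≢-nonZero t≢0}} (begin
        (p * s + 1) * t    ≡⟨ cong (_* t) (sym (σ-pow-suc k)) ⟩
        σ Q * t            ≡⟨ σQt≡2m ⟩
        2 * m              ≡⟨ cong (2 *_) (_∣_.equality st∣m) ⟩
        2 * (c * (s * t))  ≡⟨ reassoc c s t ⟩
        2 * c * s * t      ∎)
        where
        open ≡-Reasoning
        reassoc : ∀ c s t → 2 * (c * (s * t)) ≡ 2 * c * s * t
        reassoc = solve-∀

    k≡0⇔D∣m : p % 2 ≡ 1 → (k ≡ 0 ⇔ D m ℤD.∣ ℤ.+ m)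
    k≡0⇔D∣m p-odd = mk⇔ (k≡0⇒D∣m p-odd) D∣m⇒k≡0

  -- The hypotheses q ≡ 1 (mod 4) and gcd(q, n) = 1 of lemma3 enter only through these two facts.

  mod4≡1⇒odd : ∀ q → q % 4 ≡ 1 → q % 2 ≡ 1
  mod4≡1⇒odd q q≡1 = trans (sym (m∣n⇒o%n%m≡o%m 2 4 q (divides 2 refl))) (cong (_% 2) q≡1)

  -- A prime coprime to n does not divide n², since it would then divide 1.
  prime∤coprime-square : ∀ q n → Prime q → Coprime q n → ¬ q ∣ n ^ 2
  prime∤coprime-square q n q-prime q⊥n q∣n² =
    PrimeSigma.p∤1 q q-prime (coprime-divisor-pow 2 1 q⊥n (subst (q ∣_) (sym (*-identityʳ (n ^ 2))) q∣n²))

open import Data.Nat using (ℕ; _*_; _^_; _%_; _<_)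
open import Data.Nat.Primality using (Prime)
open import Data.Nat.GCD using (gcd)
open import Data.Integer using (+_)
open import Data.Integer.Divisibility using (_∣_)
open import Data.Product using (_×_)
open import Relation.Binary.PropositionalEquality using (_≡_)
open import Function.Bundles using (_⇔_)
open import Data.Nat using (zero; suc)
open import Data.Nat.Properties using (suc-injective)
open import Data.Nat.Coprimality using (gcd≡1⇒coprime)
open import Relation.Binary.PropositionalEquality using (refl; cong)
open import Function.Bundles using (mk⇔; Equivalence)
open import Function using (_∘_)
open DivisorSums

lemma3 : (N q k n : ℕ) → 0 < N → N % 2 ≡ 1 → Perfect N
    → N ≡ q ^ k * n ^ 2 → Prime q → q % 4 ≡ 1 → k % 4 ≡ 1 → gcd q n ≡ 1
    → (k ≡ 1 ⇔ D (n ^ 2) ∣ (+ (n ^ 2)))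
-- k ≡ 1 (mod 4) is used only to exclude k = 0.
-- Writing k = k' + 1, the claim is the equivalence k' ≡ 0 ⇔ D(n²) ∣ n² of EulerForm.
lemma3 N q zero n _ _ _ _ _ _ () _
lemma3 N q (suc k) n _ _ N-perfect refl q-prime q≡1 _ gcd≡1 =
  mk⇔ (to ∘ suc-injective) (cong suc ∘ from)
  where
  open Equivalence (EulerForm.k≡0⇔D∣m q k (n ^ 2) q-prime
                      (prime∤coprime-square q n q-prime (gcd≡1⇒coprime gcd≡1)) N-perfect
                      (mod4≡1⇒odd q q≡1))
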